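{- Let $p\ge1$ and $n\ge 3p+1$, and let $\sigma\in\mathcal{C}_1$ (sets $\mathcal{C}_j$ defined below for $\Delta_2^t(C_n^p)$ with vertex order $x_j=j$). Suppose there is a disconnected $2$-set $\{0,v\}$ in $\sigma^c$ with $v\ne m_\sigma-p$. Then $\sigma\notin\mathcal{C}_{m_\sigma-p+1}$.
   Context: For a graph $G$, $\Delta_2^t(G)$ is the simplicial complex whose faces are the $\sigma\subseteq V(G)$ such that $\sigma^c:=V(G)\setminus\sigma$ contains two distinct non-adjacent vertices. A disconnected $2$-set in $A\subseteq V(G)$ is a pair $\{a,b\}\subseteq A$ of distinct non-adjacent vertices. $C_n^p$ has vertex set $\{0,\dots,n-1\}$ with distinct $u,v$ adjacent iff $v\equiv u\pm t\pmod n$ for some $1\le t\le p$. For $\sigma\in\Delta_2^t(C_n^p)$, $m_\sigma:=\max(\sigma^c)$. Given vertices $x_0,\dots,x_{n-1}$, set $\mathcal{C}_0=\Delta_2^t(G)$ and for $0\le j\le n-1$ put $\mathcal{M}_{x_j}=\{\{\sigma\setminus\{x_j\},\sigma\cup\{x_j\}\}\mid \sigma\setminus\{x_j\},\sigma\cup\{x_j\}\in\mathcal{C}_j\}$ and $\mathcal{C}_{j+1}=\{\sigma\in\mathcal{C}_j\mid \sigma\text{ lies in no pair of }\mathcal{M}_{x_j}\}$. Here $G=C_n^p$ and $x_j=j$. -}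

module Defs where

open import Data.Nat using (ℕ; zero; suc; _+_; _*_; _∸_; _≤_; _<_; NonZero)
open import Data.Nat.DivMod using (_%_)
open import Data.Fin using (Fin; toℕ; fromℕ<)
open import Data.Fin.Subset using (Subset; _∈_; _∉_; _-_; _∪_; ⁅_⁆)
open import Data.Product using (Σ; ∃; _×_; ∃-syntax)
open import Data.Sum using (_⊎_)
open import Relation.Nullary using (¬_)
open import Relation.Binary.PropositionalEquality using (_≡_; _≢_)

module _ (n p : ℕ) .{{_ : NonZero n}} where

  Adj : Fin n → Fin n → Set
  Adj u v = u ≢ v × ∃[ t ] (1 ≤ t × t ≤ p ×
              ((toℕ u + t) % n ≡ toℕ v ⊎ (toℕ v + t) % n ≡ toℕ u))

  Disc2 : Subset n → Fin n → Fin n → Set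
  Disc2 A a b = a ∈ A × b ∈ A × a ≢ b × ¬ Adj a b

  -- σ is a face of Δ₂ᵗ(C_n^p): σᶜ contains two distinct non-adjacent vertices
  Face : Subset n → Set
  Face σ = ∃[ a ] ∃[ b ] (a ∉ σ × b ∉ σ × a ≢ b × ¬ Adj a b)

  InPair : (Subset n → Set) → Fin n → Subset n → Set
  InPair F x σ = ∃[ τ ] (F (τ - x) × F (τ ∪ ⁅ x ⁆) × (σ ≡ τ - x ⊎ σ ≡ τ ∪ ⁅ x ⁆))

  -- 𝒞_j, with x_j = j (only steps j < n remove anything; only j ≤ n are used)
  𝒞 : ℕ → Subset n → Set
  𝒞 zero σ = Face σ
  𝒞 (suc j) σ = 𝒞 j σ × ((lt : j < n) → ¬ InPair (𝒞 j) (fromℕ< lt) σ)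

  IsMaxComp : Subset n → Fin n → Set
  IsMaxComp σ m = m ∉ σ × (∀ w → w ∉ σ → toℕ w ≤ toℕ m)

-- Write k = m_σ − p. Since σ ∈ 𝒞₁ and 0 ∉ σ, the set σᶜ ∖ {0} is a clique; the
-- non-edge {0,v} forces p < v < n − p, and then m_σ ∈ σᶜ ∖ {0} gives v ≤ m_σ ≤ v + p,
-- so k < v as v ≠ k.
-- A vertex i < k adjacent to both v and m_σ would make n ≤ 3p, so none exists.
-- Consequently k is adjacent to every other vertex of σᶜ ∖ {0}, and both σ ∖ {k} and
-- σ ∪ {k} again have 0, v, m_σ outside and a clique σᶜ ∖ {0}. Such a set survives all
-- steps 0 < i < k: a matching pair {τ ∖ {i}, τ ∪ {i}} would put i, v, m_σ into the
-- clique of τ ∖ {i} ∈ 𝒞₁. Hence σ ∖ {k}, σ ∪ {k} ∈ 𝒞ₖ, and σ is matched at step k.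
module Submission where

open import Defs
open import Data.Nat using (ℕ; zero; suc; _+_; _*_; _∸_; _≤_; _<_; _≤′_; ≤′-refl; ≤′-step; NonZero; z≤n; s≤s; _<?_; _≤?_)
open import Data.Nat.Properties hiding (_≟_)
open import Data.Nat.DivMod using (_%_; m<n⇒m%n≡m; [m+n]%n≡m%n; m%n≤m)
open import Data.Nat.Tactic.RingSolver using (solve-∀)
open import Data.Fin using (Fin; toℕ; fromℕ<; _≟_)
open import Data.Fin.Properties using (toℕ-injective; toℕ-fromℕ<; toℕ<n) renaming (<⇒≢ to toℕ<⇒≢)
open import Data.Fin.Subset using (Subset; ∁; _∈_; _∉_; _⊆_; _─_; _-_; _∪_; ⁅_⁆; inside; outside)
open import Data.Fin.Subset.Properties using (⊆-refl; ⊆-antisym; _∈?_; p─q⊆p; p⊆p∪q; x∈p∧x≢y⇒x∈p-y; x∈p∪q⁺; x∈p∪q⁻; x∈⁅y⁆⇒x≡y; x∈⁅x⁆; x∈∁p⇒x∉p)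
open import Data.Vec using (_∷_; here; there)
open import Data.Product using (_×_; _,_; proj₁; proj₂)
open import Data.Sum using (_⊎_; inj₁; inj₂; [_,_]′)
open import Data.Empty using (⊥; ⊥-elim)
open import Function using (_∘_)
open import Relation.Nullary using (¬_; yes; no)
open import Relation.Nullary.Negation using (¬¬-map)
open import Relation.Nullary.Decidable using (decidable-stable)
open import Relation.Binary.PropositionalEquality using (_≡_; _≢_; refl; sym; trans; cong; subst; subst₂; module ≡-Reasoning)
open import Relation.Binary.Definitions using (tri<; tri≈; tri>)

m%n≡r⇒m≡r⊎r+n≤m : ∀ {m n r} .{{_ : NonZero n}} → m % n ≡ r → m ≡ r ⊎ r + n ≤ m
m%n≡r⇒m≡r⊎r+n≤m {m} {n} {r} m%n≡r with m <? n
... | yes m<n = inj₁ (trans (sym (m<n⇒m%n≡m m<n)) m%n≡r)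
... | no m≮n = inj₂ (begin
  r + n               ≡⟨ cong (_+ n) (sym m%n≡r) ⟩
  m % n + n           ≡⟨ cong (λ l → l % n + n) (sym (m∸n+n≡m n≤m)) ⟩
  (m ∸ n + n) % n + n ≡⟨ cong (_+ n) ([m+n]%n≡m%n (m ∸ n) n) ⟩
  (m ∸ n) % n + n     ≤⟨ +-monoˡ-≤ n (m%n≤m (m ∸ n) n) ⟩
  m ∸ n + n           ≡⟨ m∸n+n≡m n≤m ⟩
  m                   ∎)
  where
  open ≤-Reasoning
  n≤m : n ≤ m
  n≤m = ≮⇒≥ m≮n

x∈p─q⇒x∉q : ∀ {k} (p q : Subset k) {x} → x ∈ p ─ q → x ∉ q
x∈p─q⇒x∉q (s ∷ p)      (outside ∷ q) (there x∈) (there x∈q) = x∈p─q⇒x∉q p q x∈ x∈q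
x∈p─q⇒x∉q (inside ∷ p) (outside ∷ q) here       ()
x∈p─q⇒x∉q (s ∷ p)      (inside ∷ q)  (there x∈) (there x∈q) = x∈p─q⇒x∉q p q x∈ x∈q

module _ {k : ℕ} {p : Subset k} where

  x∉p-x : (x : Fin k) → x ∉ p - x
  x∉p-x x x∈ = x∈p─q⇒x∉q p ⁅ x ⁆ x∈ (x∈⁅x⁆ x)

  x∉p⇒x∉p-y : ∀ {x y} → x ∉ p → x ∉ p - y
  x∉p⇒x∉p-y {y = y} x∉p = x∉p ∘ p─q⊆p p ⁅ y ⁆

  x∉p-y⇒x∉p : ∀ {x y} → x ∉ p - y → x ≢ y → x ∉ p
  x∉p-y⇒x∉p x∉ x≢y x∈ = x∉ (x∈p∧x≢y⇒x∈p-y x∈ x≢y)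

  x∉p∪⁅y⁆ : ∀ {x y} → x ∉ p → x ≢ y → x ∉ p ∪ ⁅ y ⁆
  x∉p∪⁅y⁆ {y = y} x∉p x≢y x∈ with x∈p∪q⁻ p ⁅ y ⁆ x∈
  ... | inj₁ x∈p = x∉p x∈p
  ... | inj₂ x∈y = x≢y (x∈⁅y⁆⇒x≡y y x∈y)

  x∉p∪⁅y⁆⁻ : ∀ {x y} → x ∉ p ∪ ⁅ y ⁆ → x ∉ p × x ≢ y
  x∉p∪⁅y⁆⁻ {y = y} x∉ =
    x∉ ∘ p⊆p∪q ⁅ y ⁆ , λ { refl → x∉ (x∈p∪q⁺ (inj₂ (x∈⁅x⁆ y))) }

  x∉p⇒p-x≡p : ∀ {x} → x ∉ p → p - x ≡ p
  x∉p⇒p-x≡p {x} x∉p =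
    ⊆-antisym (p─q⊆p p ⁅ x ⁆) λ y∈ → x∈p∧x≢y⇒x∈p-y y∈ λ { refl → x∉p y∈ }

  x∈p⇒p∪⁅x⁆≡p : ∀ {x} → x ∈ p → p ∪ ⁅ x ⁆ ≡ p
  x∈p⇒p∪⁅x⁆≡p {x} x∈p = ⊆-antisym ∪⊆p (p⊆p∪q ⁅ x ⁆)
    where
    ∪⊆p : p ∪ ⁅ x ⁆ ⊆ p
    ∪⊆p y∈ with x∈p∪q⁻ p ⁅ x ⁆ y∈
    ... | inj₁ y∈p = y∈p
    ... | inj₂ y∈x = subst (_∈ p) (sym (x∈⁅y⁆⇒x≡y x y∈x)) x∈p

  p≡p-x⊎p≡p∪⁅x⁆ : (x : Fin k) → p ≡ p - x ⊎ p ≡ p ∪ ⁅ x ⁆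
  p≡p-x⊎p≡p∪⁅x⁆ x with x ∈? p
  ... | yes x∈p = inj₂ (sym (x∈p⇒p∪⁅x⁆≡p x∈p))
  ... | no x∉p = inj₁ (sym (x∉p⇒p-x≡p x∉p))

  p-x⊆ : ∀ {x ρ} → ρ ≡ p - x ⊎ ρ ≡ p ∪ ⁅ x ⁆ → p - x ⊆ ρ
  p-x⊆ (inj₁ refl) = ⊆-refl
  p-x⊆ {x} (inj₂ refl) = p⊆p∪q ⁅ x ⁆ ∘ p─q⊆p p ⁅ x ⁆

module _ (n p : ℕ) .{{_ : NonZero n}} where

  -- For u ≤ w: the circular distance between u and w is at most p.
  Near : Fin n → Fin n → Set
  Near u w = toℕ w ≤ toℕ u + p ⊎ toℕ u + n ≤ toℕ w + p

  Adj-sym : ∀ {u w} → Adj n p u w → Adj n p w u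
  Adj-sym (u≢w , t , 1≤t , t≤p , inj₁ e) = u≢w ∘ sym , t , 1≤t , t≤p , inj₂ e
  Adj-sym (u≢w , t , 1≤t , t≤p , inj₂ e) = u≢w ∘ sym , t , 1≤t , t≤p , inj₁ e

  Adj⇒Near : ∀ {u w} → toℕ u ≤ toℕ w → Adj n p u w → Near u w
  Adj⇒Near {u} {w} u≤w (_ , t , 1≤t , t≤p , inj₁ e) with m%n≡r⇒m≡r⊎r+n≤m e
  ... | inj₁ u+t≡w = inj₁ (subst (_≤ toℕ u + p) u+t≡w (+-monoʳ-≤ (toℕ u) t≤p))
  ... | inj₂ w+n≤u+t = inj₂ (begin
    toℕ u + n ≤⟨ +-monoˡ-≤ n u≤w ⟩
    toℕ w + n ≤⟨ w+n≤u+t ⟩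
    toℕ u + t ≤⟨ +-mono-≤ u≤w t≤p ⟩
    toℕ w + p ∎)
    where open ≤-Reasoning
  Adj⇒Near {u} {w} u≤w (_ , t , 1≤t , t≤p , inj₂ e) with m%n≡r⇒m≡r⊎r+n≤m e
  ... | inj₁ w+t≡u = ⊥-elim (<⇒≱ (subst (toℕ w <_) w+t≡u (m<m+n (toℕ w) 1≤t)) u≤w)
  ... | inj₂ u+n≤w+t = inj₂ (≤-trans u+n≤w+t (+-monoʳ-≤ (toℕ w) t≤p))

  Near⇒Adj : ∀ {u w} → toℕ u < toℕ w → Near u w → Adj n p u w
  Near⇒Adj {u} {w} u<w (inj₁ w≤u+p) =
    toℕ<⇒≢ u<w , toℕ w ∸ toℕ u , m<n⇒0<n∸m u<w ,
    m≤n+o⇒m∸n≤o (toℕ w) (toℕ u) w≤u+p ,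
    inj₁ (trans (cong (_% n) (m+[n∸m]≡n (<⇒≤ u<w))) (m<n⇒m%n≡m (toℕ<n w)))
  Near⇒Adj {u} {w} u<w (inj₂ u+n≤w+p) =
    toℕ<⇒≢ u<w , toℕ u + n ∸ toℕ w , m<n⇒0<n∸m w<u+n ,
    m≤n+o⇒m∸n≤o (toℕ u + n) (toℕ w) u+n≤w+p ,
    inj₂ (begin
      (toℕ w + (toℕ u + n ∸ toℕ w)) % n ≡⟨ cong (_% n) (m+[n∸m]≡n (<⇒≤ w<u+n)) ⟩
      (toℕ u + n) % n                 ≡⟨ [m+n]%n≡m%n (toℕ u) n ⟩
      toℕ u % n                       ≡⟨ m<n⇒m%n≡m (toℕ<n u) ⟩
      toℕ u                           ∎)
    where
    open ≡-Reasoning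
    w<u+n : toℕ w < toℕ u + n
    w<u+n = <-≤-trans (toℕ<n w) (m≤n+m n (toℕ u))

  -- ρᶜ ∖ {x} is a clique; adjacency is only ever refuted, hence the double negation.
  Clique : Fin n → Subset n → Set
  Clique x ρ = ∀ {a b} → a ∉ ρ → b ∉ ρ → a ≢ x → b ≢ x → a ≢ b → ¬ ¬ Adj n p a b

  Clique-antitone : ∀ {x ρ τ} → ρ ⊆ τ → Clique x ρ → Clique x τ
  Clique-antitone ρ⊆τ clique a∉τ b∉τ = clique (a∉τ ∘ ρ⊆τ) (b∉τ ∘ ρ⊆τ)

  Clique-extend : ∀ {x y ρ} → Clique x ρ →
                  (∀ {b} → b ∉ ρ → b ≢ x → b ≢ y → ¬ ¬ Adj n p y b) →
                  Clique x (ρ - y)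
  Clique-extend {y = y} clique y-adj {a} {b} a∉ b∉ a≢x b≢x a≢b with a ≟ y | b ≟ y
  ... | yes refl | yes refl = ⊥-elim (a≢b refl)
  ... | yes refl | no b≢y   = y-adj (x∉p-y⇒x∉p b∉ b≢y) b≢x b≢y
  ... | no a≢y   | yes refl = ¬¬-map Adj-sym (y-adj (x∉p-y⇒x∉p a∉ a≢y) a≢x a≢y)
  ... | no a≢y   | no b≢y   = clique (x∉p-y⇒x∉p a∉ a≢y) (x∉p-y⇒x∉p b∉ b≢y) a≢x b≢x a≢b

  Clique⇒¬InPair-Face : ∀ {x ρ} → x ∉ ρ → Clique x ρ → ¬ InPair n p (Face n p) x ρ
  Clique⇒¬InPair-Face x∉ρ _ (τ , _ , _ , inj₂ refl) = x∉ρ (x∈p∪q⁺ (inj₂ (x∈⁅x⁆ _)))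
  Clique⇒¬InPair-Face _ clique (τ , _ , (a , b , a∉ , b∉ , a≢b , ¬adj) , inj₁ refl) =
    let a∉τ , a≢x = x∉p∪⁅y⁆⁻ a∉
        b∉τ , b≢x = x∉p∪⁅y⁆⁻ b∉
    in clique (x∉p⇒x∉p-y a∉τ) (x∉p⇒x∉p-y b∉τ) a≢x b≢x a≢b ¬adj

  ¬InPair-Face⇒Clique : ∀ {x ρ} → x ∉ ρ → Face n p ρ →
                        ¬ InPair n p (Face n p) x ρ → Clique x ρ
  ¬InPair-Face⇒Clique {x} {ρ} x∉ρ face ¬pair {a} {b} a∉ b∉ a≢x b≢x a≢b ¬adj =
    ¬pair (ρ , subst (Face n p) (sym ρ-x≡ρ) face ,
           (a , b , x∉p∪⁅y⁆ a∉ a≢x , x∉p∪⁅y⁆ b∉ b≢x , a≢b , ¬adj) , inj₁ (sym ρ-x≡ρ))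
    where
    ρ-x≡ρ : ρ - x ≡ ρ
    ρ-x≡ρ = x∉p⇒p-x≡p x∉ρ

  𝒞-antitone : ∀ {i j ρ} → i ≤ j → 𝒞 n p j ρ → 𝒞 n p i ρ
  𝒞-antitone = go ∘ ≤⇒≤′
    where
    go : ∀ {i j ρ} → i ≤′ j → 𝒞 n p j ρ → 𝒞 n p i ρ
    go ≤′-refl c = c
    go (≤′-step i≤j) c = go i≤j (proj₁ c)

  𝒞-intro : ∀ {ρ} → Face n p ρ → ∀ j →
            (∀ i (i<n : i < n) → i < j → ¬ InPair n p (𝒞 n p i) (fromℕ< i<n) ρ) → 𝒞 n p j ρ
  𝒞-intro face zero _ = face
  𝒞-intro face (suc j) unmatched =
    𝒞-intro face j (λ i i<n i<j → unmatched i i<n (m<n⇒m<1+n i<j)) ,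
    λ j<n → unmatched j j<n ≤-refl

  fromℕ<-zero : ∀ {o} → toℕ o ≡ 0 → (0<n : 0 < n) → fromℕ< 0<n ≡ o
  fromℕ<-zero o≡0 0<n = toℕ-injective (trans (toℕ-fromℕ< 0<n) (sym o≡0))

  𝒞₁⇒Clique : ∀ {o ρ} → toℕ o ≡ 0 → o ∉ ρ → 𝒞 n p 1 ρ → Clique o ρ
  𝒞₁⇒Clique {o} o≡0 o∉ρ (face , unmatched₀) =
    ¬InPair-Face⇒Clique o∉ρ face
      (subst (λ x → ¬ InPair n p (Face n p) x _) (fromℕ<-zero o≡0 0<n) (unmatched₀ 0<n))
    where
    0<n : 0 < n
    0<n = subst (_< n) o≡0 (toℕ<n o)

module Proposition (n p : ℕ) .{{_ : NonZero n}} (3p+1≤n : 3 * p + 1 ≤ n)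
  (σ : Subset n) (σ∈𝒞₁ : 𝒞 n p 1 σ) (m : Fin n) (m-max : IsMaxComp n p σ m)
  (o v : Fin n) (o≡0 : toℕ o ≡ 0) (ov-disc : Disc2 n p (∁ σ) o v)
  (v≢k : toℕ v ≢ toℕ m ∸ p) where

  o∉σ : o ∉ σ
  o∉σ = x∈∁p⇒x∉p (proj₁ ov-disc)

  v∉σ : v ∉ σ
  v∉σ = x∈∁p⇒x∉p (proj₁ (proj₂ ov-disc))

  o≢v : o ≢ v
  o≢v = proj₁ (proj₂ (proj₂ ov-disc))

  ¬Adj-ov : ¬ Adj n p o v
  ¬Adj-ov = proj₂ (proj₂ (proj₂ ov-disc))

  m∉σ : m ∉ σ
  m∉σ = proj₁ m-max

  v≤m : toℕ v ≤ toℕ m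
  v≤m = proj₂ m-max v v∉σ

  σ-clique : Clique n p o σ
  σ-clique = 𝒞₁⇒Clique n p o≡0 o∉σ σ∈𝒞₁

  3p<n : 3 * p < n
  3p<n = subst (_≤ n) (+-comm (3 * p) 1) 3p+1≤n

  o<v : toℕ o < toℕ v
  o<v = subst (_< toℕ v) (sym o≡0)
          (n≢0⇒n>0 λ v≡0 → o≢v (toℕ-injective (trans o≡0 (sym v≡0))))

  o<m : toℕ o < toℕ m
  o<m = <-≤-trans o<v v≤m

  p<v : p < toℕ v
  p<v = ≰⇒> λ v≤p →
    ¬Adj-ov (Near⇒Adj n p o<v (inj₁ (subst (toℕ v ≤_) (cong (_+ p) (sym o≡0)) v≤p)))

  v+p<n : toℕ v + p < n
  v+p<n = ≰⇒> λ n≤v+p →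
    ¬Adj-ov (Near⇒Adj n p o<v (inj₂ (subst (_≤ toℕ v + p) (cong (_+ n) (sym o≡0)) n≤v+p)))

  ≢o : ∀ {a} → toℕ o < toℕ a → a ≢ o
  ≢o o<a = toℕ<⇒≢ o<a ∘ sym

  m≤v+p : toℕ m ≤ toℕ v + p
  m≤v+p with v ≟ m
  ... | yes refl = m≤m+n (toℕ v) p
  ... | no v≢m = decidable-stable (toℕ m ≤? toℕ v + p) λ m≰v+p →
    σ-clique v∉σ m∉σ (≢o o<v) (≢o o<m) v≢m λ adj →
      [ m≰v+p , wraps ]′ (Adj⇒Near n p v≤m adj)
    where
    wraps : toℕ v + n ≤ toℕ m + p → ⊥
    wraps v+n≤m+p = <⇒≱ p<v (+-cancelʳ-≤ n (toℕ v) p (begin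
      toℕ v + n ≤⟨ v+n≤m+p ⟩
      toℕ m + p ≤⟨ +-monoˡ-≤ p (<⇒≤ (toℕ<n m)) ⟩
      n + p     ≡⟨ +-comm n p ⟩
      p + n     ∎))
      where open ≤-Reasoning

  k : ℕ
  k = toℕ m ∸ p

  k+p≡m : k + p ≡ toℕ m
  k+p≡m = m∸n+n≡m (≤-trans (<⇒≤ p<v) v≤m)

  k<v : k < toℕ v
  k<v = ≤∧≢⇒< (m≤n+o⇒m∸n≤o (toℕ m) p (subst (toℕ m ≤_) (+-comm (toℕ v) p) m≤v+p))
              (v≢k ∘ sym)

  k<m : k < toℕ m
  k<m = <-≤-trans k<v v≤m

  k<n : k < n
  k<n = <-trans k<m (toℕ<n m)

  no-common-neighbour : ∀ {i} → toℕ i < k → Adj n p i v → Adj n p i m → ⊥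
  no-common-neighbour {i} i<k adj-v adj-m
    with Adj⇒Near n p (<⇒≤ (<-trans i<k k<v)) adj-v | Adj⇒Near n p (<⇒≤ (<-trans i<k k<m)) adj-m
  ... | inj₂ i+n≤v+p | _ = <⇒≱ v+p<n (≤-trans (m≤n+m n (toℕ i)) i+n≤v+p)
  ... | inj₁ _ | inj₁ m≤i+p = <⇒≱ (subst (toℕ i + p <_) k+p≡m (+-monoˡ-< p i<k)) m≤i+p
  ... | inj₁ v≤i+p | inj₂ i+n≤m+p = <⇒≱ 3p<n (+-cancelˡ-≤ (toℕ i) n (3 * p) (begin
    toℕ i + n         ≤⟨ i+n≤m+p ⟩
    toℕ m + p         ≤⟨ +-monoˡ-≤ p m≤v+p ⟩
    toℕ v + p + p     ≤⟨ +-monoˡ-≤ p (+-monoˡ-≤ p v≤i+p) ⟩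
    toℕ i + p + p + p ≡⟨ three-steps (toℕ i) p ⟩
    toℕ i + 3 * p     ∎))
    where
    open ≤-Reasoning
    three-steps : ∀ i p → i + p + p + p ≡ i + 3 * p
    three-steps = solve-∀

  ¬¬-no-common-neighbour : ∀ {i} → toℕ i < k → ¬ ¬ Adj n p i v → ¬ ¬ Adj n p i m → ⊥
  ¬¬-no-common-neighbour i<k ¬¬adj-v ¬¬adj-m =
    ¬¬adj-v λ adj-v → ¬¬adj-m λ adj-m → no-common-neighbour i<k adj-v adj-m

  x : Fin n
  x = fromℕ< k<n

  toℕx≡k : toℕ x ≡ k
  toℕx≡k = toℕ-fromℕ< k<n

  x≢o : x ≢ o
  x≢o = ≢o (subst₂ _<_ (sym o≡0) (sym toℕx≡k) (m<n⇒0<n∸m (<-≤-trans p<v v≤m)))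

  v≢x : v ≢ x
  v≢x = toℕ<⇒≢ (subst (_< toℕ v) (sym toℕx≡k) k<v) ∘ sym

  m≢x : m ≢ x
  m≢x = toℕ<⇒≢ (subst (_< toℕ m) (sym toℕx≡k) k<m) ∘ sym

  x-adj : ∀ {b} → b ∉ σ → b ≢ o → b ≢ x → ¬ ¬ Adj n p x b
  x-adj {b} b∉σ b≢o b≢x with <-cmp (toℕ b) k
  ... | tri< b<k _ _ = λ _ → ¬¬-no-common-neighbour b<k
    (σ-clique b∉σ v∉σ b≢o (≢o o<v) (toℕ<⇒≢ (<-trans b<k k<v)))
    (σ-clique b∉σ m∉σ b≢o (≢o o<m) (toℕ<⇒≢ (<-trans b<k k<m)))
  ... | tri≈ _ b≡k _ = ⊥-elim (b≢x (toℕ-injective (trans b≡k (sym toℕx≡k))))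
  ... | tri> _ _ k<b = λ ¬adj → ¬adj (Near⇒Adj n p (subst (_< toℕ b) (sym toℕx≡k) k<b)
    (inj₁ (subst (toℕ b ≤_) (sym (trans (cong (_+ p) toℕx≡k) k+p≡m)) (proj₂ m-max b b∉σ))))

  survives-to-k : ∀ {ρ} → o ∉ ρ → v ∉ ρ → m ∉ ρ → Clique n p o ρ → 𝒞 n p k ρ
  survives-to-k {ρ} o∉ρ v∉ρ m∉ρ ρ-clique =
    𝒞-intro n p (o , v , o∉ρ , v∉ρ , o≢v , ¬Adj-ov) k unmatched
    where
    unmatched : ∀ i (i<n : i < n) → i < k → ¬ InPair n p (𝒞 n p i) (fromℕ< i<n) ρ
    unmatched zero 0<n _ =
      subst (λ y → ¬ InPair n p (Face n p) y ρ) (sym (fromℕ<-zero n p o≡0 0<n))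
            (Clique⇒¬InPair-Face n p o∉ρ ρ-clique)
    unmatched (suc d) i<n i<k (τ , τ-y∈𝒞 , _ , ρ-eq) = ¬¬-no-common-neighbour y<k
      (τ-y-clique (x∉p-x y) v∉τ-y y≢o (≢o o<v) (toℕ<⇒≢ (<-trans y<k k<v)))
      (τ-y-clique (x∉p-x y) m∉τ-y y≢o (≢o o<m) (toℕ<⇒≢ (<-trans y<k k<m)))
      where
      y : Fin n
      y = fromℕ< i<n
      y<k : toℕ y < k
      y<k = subst (_< k) (sym (toℕ-fromℕ< i<n)) i<k
      y≢o : y ≢ o
      y≢o = ≢o (subst₂ _<_ (sym o≡0) (sym (toℕ-fromℕ< i<n)) (s≤s z≤n))
      τ-y⊆ρ : τ - y ⊆ ρ
      τ-y⊆ρ = p-x⊆ ρ-eq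
      τ-y-clique : Clique n p o (τ - y)
      τ-y-clique = 𝒞₁⇒Clique n p o≡0 (o∉ρ ∘ τ-y⊆ρ) (𝒞-antitone n p (s≤s z≤n) τ-y∈𝒞)
      v∉τ-y : v ∉ τ - y
      v∉τ-y = v∉ρ ∘ τ-y⊆ρ
      m∉τ-y : m ∉ τ - y
      m∉τ-y = m∉ρ ∘ τ-y⊆ρ

  σ∉𝒞ₖ₊₁ : ¬ 𝒞 n p (k + 1) σ
  σ∉𝒞ₖ₊₁ σ∈𝒞ₖ₊₁ = proj₂ (subst (λ j → 𝒞 n p j σ) (+-comm k 1) σ∈𝒞ₖ₊₁) k<n
    (σ , σ-x∈𝒞ₖ , σ∪x∈𝒞ₖ , p≡p-x⊎p≡p∪⁅x⁆ x)
    where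
    σ-x∈𝒞ₖ : 𝒞 n p k (σ - x)
    σ-x∈𝒞ₖ = survives-to-k (x∉p⇒x∉p-y o∉σ) (x∉p⇒x∉p-y v∉σ) (x∉p⇒x∉p-y m∉σ)
                           (Clique-extend n p σ-clique x-adj)
    σ∪x∈𝒞ₖ : 𝒞 n p k (σ ∪ ⁅ x ⁆)
    σ∪x∈𝒞ₖ = survives-to-k (x∉p∪⁅y⁆ o∉σ (x≢o ∘ sym)) (x∉p∪⁅y⁆ v∉σ v≢x) (x∉p∪⁅y⁆ m∉σ m≢x)
                           (Clique-antitone n p (p⊆p∪q ⁅ x ⁆) σ-clique)

proposition3p7 : (n p : ℕ) .{{_ : NonZero n}} → 1 ≤ p → 3 * p + 1 ≤ n →
    (σ : Subset n) → 𝒞 n p 1 σ →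
    (m : Fin n) → IsMaxComp n p σ m →
    (o v : Fin n) → toℕ o ≡ 0 → Disc2 n p (∁ σ) o v →
    toℕ v ≢ toℕ m ∸ p →
    ¬ 𝒞 n p (toℕ m ∸ p + 1) σ
proposition3p7 n p _ 3p+1≤n σ σ∈𝒞₁ m m-max o v o≡0 ov-disc v≢k =
  Proposition.σ∉𝒞ₖ₊₁ n p 3p+1≤n σ σ∈𝒞₁ m m-max o v o≡0 ov-disc v≢k
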